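{- Let $(U,\Sigma)$ be an implicational base, consisting of binary implications, of a standard distributive closure system $(U,\mathcal{F})$; let $\mathcal{B}^+$ be a non-empty antichain of $(\mathcal{F},\subseteq)$ with dual antichain $\mathcal{B}^-$; let $d\notin U$ and let $(U\cup\{d\},\mathcal{F}')$ be the closure system with $\mathcal{F}'=\{F\in\mathcal{F}:F\subseteq B\text{ for some }B\in\mathcal{B}^+\}\cup\{F\cup\{d\}:F\in\mathcal{F}\}$. Then the $D$-base of $(U\cup\{d\},\mathcal{F}')$ has size polynomial in the sizes of $(U,\Sigma)$ and $\mathcal{B}^-$.
   Context: A closure system $(U,\mathcal{F})$ on a finite set $U$: $U\in\mathcal{F}$ and closed under intersection; closure operator $\phi(A)=\bigcap\{F\in\mathcal{F}:A\subseteq F\}$. Standard: $\phi(\{a\})\setminus\{a\}\in\mathcal{F}$ for all $a$. Distributive: also closed under unions. An implication is $A\to x$; binary if $|A|=1$; an implicational base $(U,\Sigma)$ represents the closure system of all $F$ with ($A\subseteq F\Rightarrow x\in F$) for every $A\to x\in\Sigma$. Antichains $\mathcal{B}^-,\mathcal{B}^+$ of $(\mathcal{F},\subseteq)$ are dual if every $F\in\mathcal{F}$ either contains a member of $\mathcal{B}^-$ or is contained in a member of $\mathcal{B}^+$, but not both. For a closure system with closure operator $\psi$, $\psi^b(A)=\bigcup_{a\in A}\psi(\{a\})$; a minimal generator of $c$ is $A$ with $c\in\psi(A)$, $c\notin\psi(A')$ for $A'\subsetneq A$; it is a $D$-generator if $c\notin\psi^b(A)$ and every minimal generator $A'$ of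 $c$ with $A'\subseteq\psi^b(A)$ equals $A$. The $D$-base is the set of implications $\{a\to x: x\in\psi(\{a\})\setminus\{a\}\}\cup\{A\to c: A\text{ a }D\text{ -generator of }c\}$. -}

module Defs where

open import Data.Nat using (ℕ; suc; _+_)
open import Data.Fin using (Fin; zero; suc)
open import Data.Fin.Subset using (Subset; _∈_; _⊆_; _⊂_; _∪_; ⁅_⁆; ∣_∣)
open import Data.Bool using (true; false)
open import Data.Vec using (_∷_)
open import Data.List using (List; []; _∷_)
open import Data.List.Relation.Unary.Any using (Any)
open import Data.List.Relation.Unary.All using (All)
open import Data.Product using (Σ; ∃; _×_; _,_)
open import Data.Sum using (_⊎_)
open import Relation.Binary.PropositionalEquality using (_≡_; _≢_)
open import Relation.Nullary using (¬_)

Family : ℕ → Set₁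
Family m = Subset m → Set

Cl : ∀ {m} → Family m → Subset m → Fin m → Set
Cl 𝓕 A x = ∀ F → 𝓕 F → A ⊆ F → x ∈ F

-- Standard: φ({a}) \ {a} ∈ 𝓕 for every a.
Standard : ∀ {m} → Family m → Set
Standard {m} 𝓕 = ∀ (a : Fin m) (S : Subset m) →
  (∀ x → (x ∈ S → Cl 𝓕 ⁅ a ⁆ x × x ≢ a) × (Cl 𝓕 ⁅ a ⁆ x × x ≢ a → x ∈ S)) →
  𝓕 S

Distributive : ∀ {m} → Family m → Set
Distributive 𝓕 = ∀ F G → 𝓕 F → 𝓕 G → 𝓕 (F ∪ G)

BinImp : ℕ → Set
BinImp n = Fin n × Fin n

Models : ∀ {n} → List (BinImp n) → Family n
Models Σ' F = All (λ { (a , x) → a ∈ F → x ∈ F }) Σ'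

-- Antichain of (𝓕, ⊆), given as a list (of distinct members, see Unique in the statement).
Antichain : ∀ {m} → Family m → List (Subset m) → Set
Antichain 𝓕 𝓑 = All 𝓕 𝓑 × (∀ {B B'} → Any (B ≡_) 𝓑 → Any (B' ≡_) 𝓑 → B ⊆ B' → B ≡ B')

Dual : ∀ {m} → Family m → List (Subset m) → List (Subset m) → Set
Dual 𝓕 𝓑⁻ 𝓑⁺ = ∀ F → 𝓕 F →
  (Any (_⊆ F) 𝓑⁻ ⊎ Any (F ⊆_) 𝓑⁺) × ¬ (Any (_⊆ F) 𝓑⁻ × Any (F ⊆_) 𝓑⁺)

-- The extended closure system on U ∪ {d}, where U = Fin n is embedded via suc
-- and the new element d is zero : Fin (suc n). A subset of Fin (suc n) is b ∷ S
-- with b saying whether d is in it and S : Subset n its trace on U.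
Ext : ∀ {n} → Family n → List (Subset n) → Family (suc n)
Ext 𝓕 𝓑⁺ (false ∷ S) = 𝓕 S × Any (S ⊆_) 𝓑⁺
Ext 𝓕 𝓑⁺ (true ∷ S) = 𝓕 S

Clᵇ : ∀ {m} → Family m → Subset m → Fin m → Set
Clᵇ 𝓕 A x = ∃ λ a → a ∈ A × Cl 𝓕 ⁅ a ⁆ x

MinGen : ∀ {m} → Family m → Subset m → Fin m → Set
MinGen 𝓕 A c = Cl 𝓕 A c × (∀ A' → A' ⊂ A → ¬ Cl 𝓕 A' c)

DGen : ∀ {m} → Family m → Subset m → Fin m → Set
DGen 𝓕 A c = MinGen 𝓕 A c × ¬ Clᵇ 𝓕 A c ×
  (∀ A' → MinGen 𝓕 A' c → (∀ x → x ∈ A' → Clᵇ 𝓕 A x) → A' ≡ A)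

Imp : ℕ → Set
Imp m = Subset m × Fin m

InDBase : ∀ {m} → Family m → Imp m → Set
InDBase 𝓕 (A , c) =
  (∃ λ a → A ≡ ⁅ a ⁆ × Cl 𝓕 ⁅ a ⁆ c × c ≢ a) ⊎ DGen 𝓕 A c

impsSize : ∀ {m} → List (Imp m) → ℕ
impsSize [] = 0
impsSize ((A , c) ∷ L) = ∣ A ∣ + 1 + impsSize L

-- In the extended system no D-generator contains d, and, because the closure of 𝓕 is the
-- union of the closures of points, no element of U has a D-generator.  A D-generator S of d
-- has a closure that is not below any member of 𝓑⁺, so by duality it contains some B ∈ 𝓑⁻;
-- since B itself generates d, a minimal generator inside B is covered by ψᵇ(S) and the
-- D-generator condition forces it to be S.  Hence S ⊆ B ⊆ φ(S), which pins S down uniquely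
-- for B.  So the D-base consists of at most (n+1)² binary implications and at most one
-- implication per member of 𝓑⁻.
module Submission where

open import Defs
open import Data.Nat using (ℕ; suc; _+_; _*_; _^_; _≤_)
open import Data.Fin.Subset using (Subset)
open import Data.List using (List; []; length)
open import Data.List.Membership.Propositional using (_∈_)
open import Data.List.Relation.Unary.Unique.Propositional using (Unique)
open import Data.Product using (Σ; ∃; _×_)
open import Relation.Binary.PropositionalEquality using (_≢_)

open import Data.Nat using (zero; z≤n; >-nonZero)
open import Data.Nat.Properties
open import Data.Nat.Solver using (module +-*-Solver)
open import Data.Fin using (Fin; zero; suc)
open import Data.Fin.Properties using (all?; any?)
open import Data.Fin.Subset using (_⊆_; _⊂_; ⁅_⁆; ∣_∣; inside; outside)
  renaming (_∈_ to _∈ₛ_)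
open import Data.Fin.Subset.Properties
  using (_∈?_; _⊆?_; _⊂?_; anySubset?; drop-there; drop-∷-⊆; out⊆; in⊆in; out⊂in; ⊆-refl; ⊆-trans; x∈⁅x⁆; ∣p∣≤n)
open import Data.Fin.Subset.Induction using (⊂-wellFounded)
open import Data.Bool using (true)
import Data.Bool.Properties as Bool
open import Data.Vec using (_∷_; here; there; tabulate)
open import Data.Vec.Properties using (≡-dec; ∷-injectiveʳ; lookup⇒[]=; []=⇒lookup; lookup∘tabulate)
open import Data.List using (_∷_; _++_; map; allFin; cartesianProductWith; mapMaybe)
open import Data.List.Properties using (length-++; length-map; length-tabulate; length-mapMaybe)
open import Data.List.Membership.Propositional using (find)
open import Data.List.Membership.Propositional.Properties
  using (∈-++⁺ˡ; ∈-++⁺ʳ; ∈-allFin; ∈-cartesianProductWith⁺)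
open import Data.List.Relation.Unary.Any as Any using (Any)
import Data.List.Relation.Unary.Any.Properties as Any
open import Data.List.Relation.Unary.All as All using (All)
open import Data.Maybe using (Maybe; just; nothing)
import Data.Maybe.Relation.Unary.Any as Maybe
open import Data.Product using (_,_; proj₁; proj₂)
open import Data.Sum using (inj₁; inj₂)
open import Data.Empty using (⊥-elim)
open import Function using (case_of_)
open import Induction.WellFounded using (Acc; acc)
open import Relation.Nullary using (Dec; yes; no; ¬_; does)
open import Relation.Nullary.Decidable using (_×-dec_; _→-dec_; ¬?; dec-true; dec-false; decidable-stable)
open import Relation.Unary using (Decidable)
open import Relation.Binary.PropositionalEquality using (_≡_; refl; sym; trans; cong; cong₂; subst; module ≡-Reasoning)

allSubset? : ∀ {m} {P : Subset m → Set} → Decidable P → Dec (∀ S → P S)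
allSubset? P? with anySubset? (λ S → ¬? (P? S))
... | yes (S , ¬PS) = no λ ∀P → ¬PS (∀P S)
... | no ∄¬P = yes λ S → decidable-stable (P? S) λ ¬PS → ∄¬P (S , ¬PS)

subsetOf : ∀ {m} {P : Fin m → Set} → Decidable P → Subset m
subsetOf P? = tabulate λ x → does (P? x)

module _ {m} {P : Fin m → Set} (P? : Decidable P) where

  ∈-subsetOf⁺ : ∀ {x} → P x → x ∈ₛ subsetOf P?
  ∈-subsetOf⁺ {x} Px = lookup⇒[]= x _ (trans (lookup∘tabulate _ x) (dec-true (P? x) Px))

  ∈-subsetOf⁻ : ∀ {x} → x ∈ₛ subsetOf P? → P x
  ∈-subsetOf⁻ {x} x∈ = decidable-stable (P? x) λ ¬Px →
    case trans (sym does≡true) (dec-false (P? x) ¬Px) of λ ()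
    where
    does≡true : does (P? x) ≡ true
    does≡true = trans (sym (lookup∘tabulate _ x)) ([]=⇒lookup x∈)

∈-mapMaybe⁺ : ∀ {A B : Set} (f : A → Maybe B) {x y xs} → x ∈ xs → f x ≡ just y → y ∈ mapMaybe f xs
∈-mapMaybe⁺ f {x} {y} {xs} x∈xs fx≡y =
  Any.mapMaybe⁺ f xs (Any.map⁺ (Any.map (λ { refl → fx∋y }) x∈xs))
  where
  fx∋y : Maybe.Any (y ≡_) (f x)
  fx∋y = subst (Maybe.Any (y ≡_)) (sym fx≡y) (Maybe.just refl)

length-cartesianProductWith : ∀ {A B C : Set} (f : A → B → C) xs ys →
  length (cartesianProductWith f xs ys) ≡ length xs * length ys
length-cartesianProductWith f [] ys = refl
length-cartesianProductWith f (x ∷ xs) ys = begin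
  length (map (f x) ys ++ cartesianProductWith f xs ys)
    ≡⟨ length-++ (map (f x) ys) ⟩
  length (map (f x) ys) + length (cartesianProductWith f xs ys)
    ≡⟨ cong₂ _+_ (length-map (f x) ys) (length-cartesianProductWith f xs ys) ⟩
  length ys + length xs * length ys ∎
  where open ≡-Reasoning

impsSize≤ : ∀ {m} (L : List (Imp m)) → impsSize L ≤ length L * (m + 1)
impsSize≤ [] = z≤n
impsSize≤ ((A , c) ∷ L) = +-mono-≤ (+-monoˡ-≤ 1 (∣p∣≤n A)) (impsSize≤ L)

module ClosureOperator {m} {𝓕 : Family m} (𝓕? : Decidable 𝓕) where

  Cl? : ∀ A x → Dec (Cl 𝓕 A x)
  Cl? A x = allSubset? λ F → 𝓕? F →-dec (A ⊆? F →-dec x ∈? F)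

  Clᵇ? : ∀ A x → Dec (Clᵇ 𝓕 A x)
  Clᵇ? A x = any? λ a → a ∈? A ×-dec Cl? ⁅ a ⁆ x

  MinGen? : ∀ A c → Dec (MinGen 𝓕 A c)
  MinGen? A c = Cl? A c ×-dec allSubset? (λ A' → A' ⊂? A →-dec ¬? (Cl? A' c))

  DGen? : ∀ A c → Dec (DGen 𝓕 A c)
  DGen? A c = MinGen? A c ×-dec ¬? (Clᵇ? A c) ×-dec allSubset? λ A' →
    MinGen? A' c →-dec (all? (λ x → x ∈? A' →-dec Clᵇ? A x) →-dec ≡-dec Bool._≟_ A' A)

  minGen-⊆ : ∀ {A c} → Cl 𝓕 A c → ∃ λ A' → A' ⊆ A × MinGen 𝓕 A' c
  minGen-⊆ {A} {c} = go A (⊂-wellFounded A)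
    where
    go : ∀ A → Acc _⊂_ A → Cl 𝓕 A c → ∃ λ A' → A' ⊆ A × MinGen 𝓕 A' c
    go A (acc smaller) A→c with anySubset? (λ A' → A' ⊂? A ×-dec Cl? A' c)
    ... | yes (A' , A'⊂A , A'→c) =
      let A'' , A''⊆A' , minGen = go A' (smaller A'⊂A) A'→c
      in A'' , ⊆-trans A''⊆A' (proj₁ A'⊂A) , minGen
    ... | no ∄smaller = A , ⊆-refl , A→c , λ A' A'⊂A A'→c → ∄smaller (A' , A'⊂A , A'→c)

  closure : Subset m → Subset m
  closure A = subsetOf (Cl? A)

  ∈-closure⁺ : ∀ {A x} → Cl 𝓕 A x → x ∈ₛ closure A
  ∈-closure⁺ {A} = ∈-subsetOf⁺ (Cl? A)

  ∈-closure⁻ : ∀ {A x} → x ∈ₛ closure A → Cl 𝓕 A x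
  ∈-closure⁻ {A} = ∈-subsetOf⁻ (Cl? A)

  closure-extensive : ∀ {A} → A ⊆ closure A
  closure-extensive x∈A = ∈-closure⁺ λ F _ A⊆F → A⊆F x∈A

module BinaryImplications {n} (Σ' : List (BinImp n)) where

  Models? : Decidable (Models Σ')
  Models? F = All.all? (λ { (a , x) → a ∈? F →-dec x ∈? F }) Σ'

  open ClosureOperator Models?

  Cl-modusPonens : ∀ {A a x} → (a , x) ∈ Σ' → Cl (Models Σ') A a → Cl (Models Σ') A x
  Cl-modusPonens a→x∈Σ A→a F F⊨Σ A⊆F = All.lookup F⊨Σ a→x∈Σ (A→a F F⊨Σ A⊆F)

  closure-closed : ∀ A → Models Σ' (closure A)
  closure-closed A = All.tabulate λ a→x∈Σ a∈φA →
    ∈-closure⁺ (Cl-modusPonens a→x∈Σ (∈-closure⁻ a∈φA))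

  -- ψᵇ(A) is itself a model of Σ', since every implication has a single premise.
  Cl⇒Clᵇ : ∀ {A x} → Cl (Models Σ') A x → Clᵇ (Models Σ') A x
  Cl⇒Clᵇ {A} A→x = ∈-subsetOf⁻ (Clᵇ? A) (A→x ψᵇA ψᵇA-closed A⊆ψᵇA)
    where
    ψᵇA : Subset n
    ψᵇA = subsetOf (Clᵇ? A)

    ψᵇA-closed : Models Σ' ψᵇA
    ψᵇA-closed = All.tabulate λ a→x∈Σ a∈ψᵇA →
      let b , b∈A , b→a = ∈-subsetOf⁻ (Clᵇ? A) a∈ψᵇA
      in ∈-subsetOf⁺ (Clᵇ? A) (b , b∈A , Cl-modusPonens a→x∈Σ b→a)

    A⊆ψᵇA : A ⊆ ψᵇA
    A⊆ψᵇA {a} a∈A = ∈-subsetOf⁺ (Clᵇ? A) (a , a∈A , λ _ _ ⁅a⁆⊆F → ⁅a⁆⊆F (x∈⁅x⁆ a))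

module Extension {n} {𝓕 : Family n} (𝓕? : Decidable 𝓕)
  (closure-closed : ∀ A → 𝓕 (ClosureOperator.closure 𝓕? A))
  (Cl⇒Clᵇ : ∀ {A x} → Cl 𝓕 A x → Clᵇ 𝓕 A x)
  (𝓑⁺ 𝓑⁻ : List (Subset n)) (dual : Dual 𝓕 𝓑⁻ 𝓑⁺) where

  open ClosureOperator 𝓕? using (closure; ∈-closure⁺; ∈-closure⁻; closure-extensive)

  𝓕′ : Family (suc n)
  𝓕′ = Ext 𝓕 𝓑⁺

  Ext? : Decidable 𝓕′
  Ext? (outside ∷ F) = 𝓕? F ×-dec Any.any? (F ⊆?_) 𝓑⁺
  Ext? (inside ∷ F) = 𝓕? F

  open ClosureOperator Ext? using (DGen?; minGen-⊆)

  trace-closed : ∀ {b F} → 𝓕′ (b ∷ F) → 𝓕 F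
  trace-closed {outside} = proj₁
  trace-closed {inside} F∈𝓕 = F∈𝓕

  Cl-Ext⁺ : ∀ {A x} → Cl 𝓕 A x → Cl 𝓕′ (outside ∷ A) (suc x)
  Cl-Ext⁺ A→x (b ∷ F) F∈𝓕′ A⊆F = there (A→x F (trace-closed {b} F∈𝓕′) (drop-∷-⊆ A⊆F))

  Cl-Ext⁻ : ∀ {A x} → Cl 𝓕′ (outside ∷ A) (suc x) → Cl 𝓕 A x
  Cl-Ext⁻ A→x F F∈𝓕 A⊆F = drop-there (A→x (inside ∷ F) F∈𝓕 (out⊆ A⊆F))

  Clᵇ-Ext⁺ : ∀ {A x} → Clᵇ 𝓕 A x → Clᵇ 𝓕′ (outside ∷ A) (suc x)
  Clᵇ-Ext⁺ (a , a∈A , a→x) = suc a , there a∈A , Cl-Ext⁺ a→x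

  -- Adding d to a closed set keeps it closed, so d never helps to generate an element of U.
  Cl-Ext-without-d : ∀ {A x} → Cl 𝓕′ (inside ∷ A) (suc x) → Cl 𝓕′ (outside ∷ A) (suc x)
  Cl-Ext-without-d A→x (b ∷ F) F∈𝓕′ A⊆F =
    there (drop-there (A→x (inside ∷ F) (trace-closed {b} F∈𝓕′) (in⊆in (drop-∷-⊆ A⊆F))))

  ¬DGen-inside : ∀ {A c} → ¬ DGen 𝓕′ (inside ∷ A) c
  ¬DGen-inside {A} {zero} (_ , ¬Clᵇ , _) = ¬Clᵇ (zero , here , λ _ _ ⁅d⁆⊆F → ⁅d⁆⊆F here)
  ¬DGen-inside {A} {suc x} ((A→x , minimal) , _) =
    minimal (outside ∷ A) (out⊂in ⊆-refl) (Cl-Ext-without-d A→x)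

  ¬DGen-suc : ∀ {A x} → ¬ DGen 𝓕′ (outside ∷ A) (suc x)
  ¬DGen-suc ((A→x , _) , ¬Clᵇ , _) = ¬Clᵇ (Clᵇ-Ext⁺ (Cl⇒Clᵇ (Cl-Ext⁻ A→x)))

  d : Fin (suc n)
  d = zero

  closure-⊇-𝓑⁻ : ∀ {A} → Cl 𝓕′ (outside ∷ A) d → Any (_⊆ closure A) 𝓑⁻
  closure-⊇-𝓑⁻ {A} A→d with proj₁ (dual (closure A) (closure-closed A))
  ... | inj₁ B⊆φA = B⊆φA
  ... | inj₂ φA⊆B⁺ with A→d (outside ∷ closure A) (closure-closed A , φA⊆B⁺) (out⊆ closure-extensive)
  ... | ()

  𝓑⁻-generates-d : ∀ {B} → B ∈ 𝓑⁻ → Cl 𝓕′ (outside ∷ B) d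
  𝓑⁻-generates-d B∈𝓑⁻ (outside ∷ F) (F∈𝓕 , F⊆B⁺) B⊆F =
    ⊥-elim (proj₂ (dual F F∈𝓕) (F-above-𝓑⁻ , F⊆B⁺))
    where
    F-above-𝓑⁻ : Any (_⊆ F) 𝓑⁻
    F-above-𝓑⁻ = Any.map {Q = _⊆ F} (λ B≡B′ → subst (_⊆ F) B≡B′ (drop-∷-⊆ B⊆F)) B∈𝓑⁻
  𝓑⁻-generates-d _ (inside ∷ F) _ _ = here

  ⊆closure⇒Clᵇ : ∀ {A A'} → A' ⊆ outside ∷ closure A → ∀ x → x ∈ₛ A' → Clᵇ 𝓕′ (outside ∷ A) x
  ⊆closure⇒Clᵇ A'⊆φA zero x∈A' with A'⊆φA x∈A'
  ... | ()
  ⊆closure⇒Clᵇ A'⊆φA (suc x) x∈A' = Clᵇ-Ext⁺ (Cl⇒Clᵇ (∈-closure⁻ (drop-there (A'⊆φA x∈A'))))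

  -- A minimal generator of d inside B is covered by ψᵇ(A), so it is A itself.
  DGen-d-⊆ : ∀ {A B} → B ∈ 𝓑⁻ → DGen 𝓕′ (outside ∷ A) d → B ⊆ closure A → A ⊆ B
  DGen-d-⊆ B∈𝓑⁻ (_ , _ , onlyCovered) B⊆φA a∈A =
    let A' , A'⊆B , minGen = minGen-⊆ (𝓑⁻-generates-d B∈𝓑⁻)
        A'≡A = onlyCovered A' minGen (⊆closure⇒Clᵇ (⊆-trans A'⊆B (out⊆ B⊆φA)))
    in drop-there (A'⊆B (subst (suc _ ∈ₛ_) (sym A'≡A) (there a∈A)))

  DGen-d-over : Subset n → Subset n → Set
  DGen-d-over B A = DGen 𝓕′ (outside ∷ A) d × B ⊆ closure A

  DGen-d-over? : ∀ B A → Dec (DGen-d-over B A)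
  DGen-d-over? B A = DGen? (outside ∷ A) d ×-dec B ⊆? closure A

  DGen-d-over-unique : ∀ {A₁ A₂ B} → B ∈ 𝓑⁻ → DGen-d-over B A₁ → DGen-d-over B A₂ → A₁ ≡ A₂
  DGen-d-over-unique B∈𝓑⁻ ((_ , _ , onlyCovered₁) , B⊆φA₁) (dGen₂@(minGen₂ , _) , B⊆φA₂) =
    sym (∷-injectiveʳ (onlyCovered₁ _ minGen₂
      (⊆closure⇒Clᵇ (out⊆ (⊆-trans (DGen-d-⊆ B∈𝓑⁻ dGen₂ B⊆φA₂) B⊆φA₁)))))

  DGen-d-imp : Subset n → Maybe (Imp (suc n))
  DGen-d-imp B with anySubset? (DGen-d-over? B)
  ... | yes (A , _) = just (outside ∷ A , d)
  ... | no _ = nothing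

  DGen-d-imp-just : ∀ {A B} → B ∈ 𝓑⁻ → DGen-d-over B A → DGen-d-imp B ≡ just (outside ∷ A , d)
  DGen-d-imp-just {B = B} B∈𝓑⁻ A-over-B with anySubset? (DGen-d-over? B)
  ... | yes (A' , A'-over-B) =
    cong (λ A → just (outside ∷ A , d)) (DGen-d-over-unique B∈𝓑⁻ A'-over-B A-over-B)
  ... | no ∄A = ⊥-elim (∄A (_ , A-over-B))

  binaryImps : List (Imp (suc n))
  binaryImps = cartesianProductWith (λ a c → ⁅ a ⁆ , c) (allFin (suc n)) (allFin (suc n))

  dBaseCover : List (Imp (suc n))
  dBaseCover = binaryImps ++ mapMaybe DGen-d-imp 𝓑⁻

  DBase⊆dBaseCover : ∀ i → InDBase 𝓕′ i → i ∈ dBaseCover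
  DBase⊆dBaseCover (_ , c) (inj₁ (a , refl , _)) =
    ∈-++⁺ˡ (∈-cartesianProductWith⁺ _ (∈-allFin a) (∈-allFin c))
  DBase⊆dBaseCover (inside ∷ A , c) (inj₂ dGen) = ⊥-elim (¬DGen-inside dGen)
  DBase⊆dBaseCover (outside ∷ A , suc x) (inj₂ dGen) = ⊥-elim (¬DGen-suc dGen)
  DBase⊆dBaseCover (outside ∷ A , zero) (inj₂ dGen) =
    let B , B∈𝓑⁻ , B⊆φA = find (closure-⊇-𝓑⁻ (proj₁ (proj₁ dGen)))
    in ∈-++⁺ʳ binaryImps (∈-mapMaybe⁺ DGen-d-imp B∈𝓑⁻ (DGen-d-imp-just B∈𝓑⁻ (dGen , B⊆φA)))

  length-binaryImps : length binaryImps ≡ suc n * suc n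
  length-binaryImps = trans (length-cartesianProductWith _ (allFin (suc n)) (allFin (suc n)))
    (cong₂ _*_ length-allFin length-allFin)
    where
    length-allFin : length (allFin (suc n)) ≡ suc n
    length-allFin = length-tabulate (λ x → x)

  length-dBaseCover : length dBaseCover ≤ suc n * suc n + length 𝓑⁻
  length-dBaseCover = begin
    length dBaseCover
      ≡⟨ length-++ binaryImps ⟩
    length binaryImps + length (mapMaybe DGen-d-imp 𝓑⁻)
      ≤⟨ +-mono-≤ (≤-reflexive length-binaryImps) (length-mapMaybe DGen-d-imp 𝓑⁻) ⟩
    suc n * suc n + length 𝓑⁻ ∎
    where open ≤-Reasoning

cubic-bound : ∀ n s b → (suc n * suc n + b) * (suc n + 1) ≤ 4 * (n + s + b + 1) ^ 3
cubic-bound n s b = begin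
  (suc n * suc n + b) * (suc n + 1)
    ≤⟨ *-mono-≤ (+-mono-≤ (*-mono-≤ n<N n<N) (≤-trans b≤N N≤N*N)) (+-mono-≤ n<N 0<N) ⟩
  (N * N + N * N) * (N + N)
    ≡⟨ solve 1 (λ N → (N :* N :+ N :* N) :* (N :+ N) := con 4 :* N :^ 3) refl N ⟩
  4 * N ^ 3 ∎
  where
  open ≤-Reasoning
  open +-*-Solver
  N = n + s + b + 1
  n<N : suc n ≤ N
  n<N = ≤-trans (≤-reflexive (+-comm 1 n)) (+-monoˡ-≤ 1 (≤-trans (m≤m+n n s) (m≤m+n (n + s) b)))
  b≤N : b ≤ N
  b≤N = ≤-trans (m≤n+m b (n + s)) (m≤m+n (n + s + b) 1)
  0<N : 1 ≤ N
  0<N = m≤n+m 1 (n + s + b)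
  N≤N*N : N ≤ N * N
  N≤N*N = m≤m*n N N {{>-nonZero 0<N}}

proposition3 : Σ ℕ λ c → Σ ℕ λ k →
    ∀ (n : ℕ) (Σ' : List (BinImp n)) (𝓑⁺ 𝓑⁻ : List (Subset n)) →
    Unique Σ' → Standard (Models Σ') → Distributive (Models Σ') →
    Unique 𝓑⁺ → Unique 𝓑⁻ →
    Antichain (Models Σ') 𝓑⁺ → Antichain (Models Σ') 𝓑⁻ → 𝓑⁺ ≢ [] →
    Dual (Models Σ') 𝓑⁻ 𝓑⁺ →
    ∃ λ (L : List (Imp (suc n))) →
      (∀ i → InDBase (Ext (Models Σ') 𝓑⁺) i → i ∈ L) ×
      impsSize L ≤ c * (n + length Σ' + length 𝓑⁻ + 1) ^ k
proposition3 = 4 , 3 , λ n Σ' 𝓑⁺ 𝓑⁻ _ _ _ _ _ _ _ _ dual →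
  let open BinaryImplications Σ'
      open Extension Models? closure-closed Cl⇒Clᵇ 𝓑⁺ 𝓑⁻ dual
  in dBaseCover , DBase⊆dBaseCover , (begin
       impsSize dBaseCover
         ≤⟨ impsSize≤ dBaseCover ⟩
       length dBaseCover * (suc n + 1)
         ≤⟨ *-monoˡ-≤ (suc n + 1) length-dBaseCover ⟩
       (suc n * suc n + length 𝓑⁻) * (suc n + 1)
         ≤⟨ cubic-bound n (length Σ') (length 𝓑⁻) ⟩
       4 * (n + length Σ' + length 𝓑⁻ + 1) ^ 3 ∎)
  where open ≤-Reasoning
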